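{- For packed words $u$ and $v$ (of lengths at least $1$), $\mathbf{S}^u\#\mathbf{S}^v=\mathbf{S}^{u\vee v}$.
   Context: Let $A=\{a_1<a_2<\cdots\}$ be an infinite totally ordered alphabet (identified with $\{1<2<\cdots\}$) and $\mathbb{K}$ a field; work with formal $\mathbb{K}$-linear combinations of nonempty words over $A$. The $\#$ product of words is $(ux)\#(yv)=uxv$ if the letters $x,y$ are equal and $0$ otherwise ($u,v$ words, $x,y$ letters), extended bilinearly. For a word $w$ with distinct letters $b_1<\dots<b_r$, $\mathrm{pack}(w)$ is the image of $w$ under $b_i\mapsto i$; $w$ is packed if $\mathrm{pack}(w)=w$; $\mathbf{M}_u=\sum_{\mathrm{pack}(w)=u}w$. For a packed word $w$ and $i<j$, the pair $(i,j)$ has coefficient $1$ if $w_i>w_j$, $1/2$ if $w_i=w_j$, $0$ otherwise; $u\le v$ (pseudo-permutohedron order, same length) iff every pair's coefficient in $u$ is at most its coefficient in $v$. $\mathbf{S}^u=\sum_{v\le u}\mathbf{M}_v$. For packed words $\alpha$ of length $k$ and $\beta$ of length $l$, $\alpha\vee\beta$ is obtained by writing, for $i=1,\dots,k$, $\alpha_i+\beta_1-1$ if $\alpha_i\le\alpha_k$ and $\alpha_i+\max(\beta)-1$ if $\alpha_i>\alpha_k$; then for $i=2,\dots,l$, $\beta_i$ if $\beta_i<\beta_1$ and $\beta_i+\alpha_k-1$ if $\beta_i\ge\beta_1$. -}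

module Defs where

open import Level using (Level; suc; _⊔_)
open import Data.Bool using (Bool; true; false; if_then_else_; _∧_; not)
open import Data.Nat as ℕ using (ℕ; zero; _∸_; _<ᵇ_; _≡ᵇ_)
open import Data.List using (List; []; _∷_; map; length; filter; deduplicate; foldr; take; drop; upTo; concatMap; applyUpTo; last; head)
open import Data.Bool.ListAction using (and)
open import Data.Maybe using (Maybe; just; nothing; fromMaybe)
open import Data.Product using (_×_; _,_)
open import Relation.Nullary using (¬_)
open import Relation.Nullary.Decidable using (⌊_⌋)
open import Relation.Binary.PropositionalEquality using (_≡_)
open import Algebra.Bundles using (CommutativeRing)

record Field (c ℓ : Level) : Set (suc (c ⊔ ℓ)) where
  field
    commutativeRing : CommutativeRing c ℓ
  open CommutativeRing commutativeRing public
  field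
    0≉1     : ¬ (0# ≈ 1#)
    inv     : (x : Carrier) → ¬ (x ≈ 0#) → Carrier
    inverse : (x : Carrier) (x≉0 : ¬ (x ≈ 0#)) → x * inv x x≉0 ≈ 1#

-- Words over the alphabet A = ℕ (an infinite totally ordered alphabet,
-- order-isomorphic to {1 < 2 < ...}).  Words are lists; the empty list
-- is not a word (series are only compared on nonempty words).

Word : Set
Word = List ℕ

-- safe indexing (only used with in-range indices)
at : Word → ℕ → ℕ
at []       _       = 0
at (x ∷ w)  zero    = x
at (x ∷ w) (ℕ.suc i) = at w i

#distinctBelow : Word → ℕ → ℕ
#distinctBelow w x = length (deduplicate ℕ._≟_ (filter (λ y → y ℕ.<? x) w))

-- pack(w): the image of w under b_i ↦ i, where b_1 < ... < b_r are the
-- distinct letters of w  (b_i has exactly i-1 distinct letters below it).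
pack : Word → Word
pack w = map (λ x → ℕ.suc (#distinctBelow w x)) w

IsPacked : Word → Set
IsPacked w = pack w ≡ w

isPackedᵇ : Word → Bool
isPackedᵇ w = ⌊ Data.List.Properties.≡-dec ℕ._≟_ (pack w) w ⌋
  where import Data.List.Properties

-- Coefficient of the pair (i,j), i<j, is
-- 1 if w_i > w_j, 1/2 if w_i = w_j, 0 otherwise; we store TWICE the
-- coefficient (2, 1, 0) to stay in ℕ -- comparisons are unaffected.

coef2 : Word → ℕ → ℕ → ℕ
coef2 w i j =
  if at w j <ᵇ at w i then 2 else (if at w i ≡ᵇ at w j then 1 else 0)

_≤ᵖ_ : Word → Word → Bool
u ≤ᵖ v = (length u ≡ᵇ length v) ∧
  and (concatMap (λ j → map (λ i → coef2 u i j ℕ.≤ᵇ coef2 v i j) (upTo j))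
                 (upTo (length u)))

-- All words of length n over the letters {1,...,n}; the packed words of
-- length n are exactly the packed ones among these.
wordsOver : ℕ → ℕ → List Word
wordsOver m zero      = [] ∷ []
wordsOver m (ℕ.suc n) = concatMap (λ x → map (x ∷_) (wordsOver m n)) (applyUpTo ℕ.suc m)

packedWords : ℕ → List Word
packedWords n = filter (λ w → Data.Bool._≟_ (isPackedᵇ w) true) (wordsOver n n)
  where import Data.Bool

-- Formal (possibly infinite) K-linear combinations of words = series:
-- a coefficient for every word.

module Series {c ℓ} (K : Field c ℓ) where
  open Field K

  Ser : Set c
  Ser = Word → Carrier

  ΣL : {X : Set} → List X → (X → Ser) → Ser
  ΣL xs f w = foldr (λ x acc → f x w + acc) 0# xs

  -- M_u = Σ_{pack(w) = u} w
  M : Word → Ser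
  M u w = if ⌊ Data.List.Properties.≡-dec ℕ._≟_ (pack w) u ⌋ then 1# else 0#
    where import Data.List.Properties

  S : Word → Ser
  S u = ΣL (filter (λ v → Data.Bool._≟_ (v ≤ᵖ u) true) (packedWords (length u))) M
    where import Data.Bool

  -- The # product, extended bilinearly (and coefficientwise to series):
  -- (ux)#(yv) = uxv if x = y, else 0.  A nonempty word w = w_1...w_n is
  -- obtained as w₁ # w₂ exactly for w₁ = w_1...w_k, w₂ = w_k...w_n
  -- (1 ≤ k ≤ n), each such pair contributing once, so
  --   (f # g)(w) = Σ_{k=1}^{n} f(w_1...w_k) · g(w_k...w_n).
  _#_ : Ser → Ser → Ser
  (f # g) w = foldr (λ k acc → f (take k w) * g (drop (k ∸ 1) w) + acc) 0#
                    (applyUpTo ℕ.suc (length w))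

  _≋_ : Ser → Ser → Set ℓ
  f ≋ g = (w : Word) → ¬ (w ≡ []) → f w ≈ g w

maxL : Word → ℕ
maxL = foldr ℕ._⊔_ 0

_∨ᵖ_ : Word → Word → Word
α ∨ᵖ [] = α  -- not used (β nonempty)
α ∨ᵖ (b₁ ∷ βs) =
  map (λ a → if a ℕ.≤ᵇ αk then a ℕ.+ b₁ ∸ 1 else a ℕ.+ maxβ ∸ 1) α
  Data.List.++ map (λ b → if b <ᵇ b₁ then b else b ℕ.+ αk ∸ 1) βs
  where
    import Data.List
    αk   = fromMaybe 0 (last α)
    maxβ = maxL (b₁ ∷ βs)

-- S^u(w) is 1 when pack w ≤ u and 0 otherwise, since every packed word occurs
-- once among the summands of S^u. As S^u vanishes off words of length k + 1 =
-- |u|, only one term of (S^u # S^v)(w) survives: [w₁…w_{k+1} ≤ u][w_{k+1}…w_n ≤ v].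
-- In u ∨ v the first k + 1 letters are an order-isomorphic copy of u and the
-- last |v| letters one of v, the two blocks sharing the letter at position k + 1.
-- A pair straddling that letter is an inversion of u ∨ v whenever its left end
-- exceeds u_{k+1} or its right end lies below v₁, and otherwise it compares
-- through the shared letter. So w ≤ u ∨ v iff both blocks of w lie below u and v.
module Submission where

open import Defs
open import Level using (0ℓ)
open import Algebra.Bundles using (Monoid)
open import Data.Bool as Bool using (Bool; true; false; if_then_else_; T; _∧_)
open import Data.Bool.ListAction using (and)
open import Data.Bool.Properties using (T-∧; T-≡)
open import Data.Empty using (⊥-elim)
open import Data.List
  using ( List; []; _∷_; map; length; filter; deduplicate; foldr; take; drop; concatMap
        ; applyUpTo; last; _++_; cartesianProductWith
        )
open import Data.List.Properties
  using ( length-map; length-++; length-take; length-drop; filter-accept; filter-reject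
        ; filter-all; filter-notAll; length-deduplicate; map-∘; map-cong-local; ≡-dec
        ; ∷-injective
        )
open import Data.List.Membership.Propositional using (_∈_)
open import Data.List.Membership.Propositional.Properties
  using ( ∈-filter⁺; ∈-filter⁻; ∈-deduplicate⁺; ∈-deduplicate⁻; ∈-applyUpTo⁺; ∈-applyUpTo⁻
        ; ∈-cartesianProductWith⁺
        )
open import Data.List.Relation.Unary.All as All using (All; []; _∷_)
import Data.List.Relation.Unary.All.Properties as All
open import Data.List.Relation.Unary.Any as Any using (here; there)
open import Data.List.Relation.Unary.Unique.Propositional using (Unique)
import Data.List.Relation.Unary.AllPairs as AllPairs
import Data.List.Relation.Unary.Unique.Propositional.Properties as Unique
open import Data.Maybe using (fromMaybe)
open import Data.Nat
  using ( ℕ; zero; suc; _+_; _∸_; _≤_; _<_; z≤n; s≤s; _≤ᵇ_; _<ᵇ_; _≡ᵇ_; _≟_; _≤?_; _<?_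
        )
open import Data.Nat.Properties
  using ( <-asym; <-cmp; <-irrefl; <-trans; <-≤-trans; ≤-<-trans; ≤-refl; ≤-reflexive
        ; ≤-trans; <⇒≤; ≰⇒>; <ᵇ⇒<; <⇒<ᵇ; ≡ᵇ⇒≡; ≡⇒≡ᵇ; ≤ᵇ⇒≤; ≤⇒≤ᵇ; +-cancelˡ-<; +-monoʳ-<
        ; m≤n⇒m<n∨m≡n; m≤n⇒m≤1+n; m≤n⇒∃[o]m+o≡n; n<1+n; n≤1+n; suc-injective; m≤n⇒m⊓n≡m
        ; m≥n⇒m⊓n≡n; <⇒≢; ≤-pred; <⇒≱; ≤⇒≯; ≮⇒≥; +-suc; +-comm; +-monoˡ-<; +-monoˡ-≤
        ; +-mono-<-≤; +-mono-≤; m≤m+n; m≤n+m; m≤m⊔n; m≤n⇒m≤o⊔n; +-identityʳ; m+n∸m≡n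
        ; m+[n∸m]≡n; m∸n≢0⇒n<m; 0≢1+n
        )
open import Data.Product using (_×_; _,_; proj₁; proj₂)
open import Data.Product.Function.NonDependent.Propositional using (_×-⇔_)
open import Data.Sum as Sum using (_⊎_; inj₁; inj₂)
import Function.Properties.Equivalence as ⇔
open import Function using (_∘_; id; _⇔_; mk⇔; Equivalence)
open import Relation.Binary.Core using (_Preserves_⟶_)
open import Relation.Binary.Definitions using (tri<; tri≈; tri>)
open import Relation.Binary.PropositionalEquality
  using ( _≡_; _≢_; ≢-sym; refl; cong; cong₂; sym; trans; subst; subst₂
        ; module ≡-Reasoning
        )
open import Relation.Nullary using (¬_; yes; no; Dec; ¬?)
open import Relation.Nullary.Decidable using (⌊_⌋)
open import Relation.Unary using (Pred; Decidable)

if-T : ∀ {a} {A : Set a} {b} {x y : A} → T b → (if b then x else y) ≡ x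
if-T {b = true} _ = refl

if-¬T : ∀ {a} {A : Set a} {b} {x y : A} → ¬ T b → (if b then x else y) ≡ y
if-¬T {b = false} _ = refl
if-¬T {b = true} ¬t = ⊥-elim (¬t _)

⌊⌋-true : ∀ {A : Set} (d : Dec A) → A → ⌊ d ⌋ ≡ true
⌊⌋-true (yes _) _ = refl
⌊⌋-true (no ¬a) a = ⊥-elim (¬a a)

⌊⌋-false : ∀ {A : Set} (d : Dec A) → ¬ A → ⌊ d ⌋ ≡ false
⌊⌋-false (yes a) ¬a = ⊥-elim (¬a a)
⌊⌋-false (no _) _ = refl

-- Opaque, so that unification can recover x from pairCoef (x i) (x j);
-- outside this block it is used only through its three cases.
opaque
  pairCoef : ℕ → ℕ → ℕ
  pairCoef x y = if y <ᵇ x then 2 else (if x ≡ᵇ y then 1 else 0)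

  coef2≡pairCoef : ∀ w i j → coef2 w i j ≡ pairCoef (at w i) (at w j)
  coef2≡pairCoef w i j = refl

  pairCoef-< : ∀ {x y} → x < y → pairCoef x y ≡ 0
  pairCoef-< {x} {y} x<y =
    trans (if-¬T (<-asym x<y ∘ <ᵇ⇒< y x)) (if-¬T ((λ x≡y → <-irrefl x≡y x<y) ∘ ≡ᵇ⇒≡ x y))

  pairCoef-≡ : ∀ x → pairCoef x x ≡ 1
  pairCoef-≡ x = trans (if-¬T (<-irrefl refl ∘ <ᵇ⇒< x x)) (if-T (≡⇒≡ᵇ x x refl))

  pairCoef-> : ∀ {x y} → y < x → pairCoef x y ≡ 2
  pairCoef-> y<x = if-T (<⇒<ᵇ y<x)

pairCoef≤2 : ∀ x y → pairCoef x y ≤ 2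
pairCoef≤2 x y with <-cmp x y
... | tri< x<y _ _ = ≤-trans (≤-reflexive (pairCoef-< x<y)) z≤n
... | tri≈ _ refl _ = ≤-trans (≤-reflexive (pairCoef-≡ x)) (n≤1+n 1)
... | tri> _ _ y<x = ≤-reflexive (pairCoef-> y<x)

pairCoef≤1⇒≤ : ∀ {x y} → pairCoef x y ≤ 1 → x ≤ y
pairCoef≤1⇒≤ {x} {y} c≤1 with <-cmp x y
... | tri< x<y _ _ = <⇒≤ x<y
... | tri≈ _ refl _ = ≤-refl
... | tri> _ _ y<x with s≤s () ← subst (_≤ 1) (pairCoef-> y<x) c≤1

pairCoef≡2⇒> : ∀ {x y} → pairCoef x y ≡ 2 → y < x
pairCoef≡2⇒> {x} {y} c≡2 with <-cmp x y
... | tri< x<y _ _ with () ← trans (sym (pairCoef-< x<y)) c≡2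
... | tri≈ _ refl _ with () ← trans (sym (pairCoef-≡ x)) c≡2
... | tri> _ _ y<x = y<x

pairCoef≤0⇒< : ∀ {x y} → pairCoef x y ≤ 0 → x < y
pairCoef≤0⇒< {x} {y} c≤0 with <-cmp x y
... | tri< x<y _ _ = x<y
... | tri≈ _ refl _ with () ← subst (_≤ 0) (pairCoef-≡ x) c≤0
... | tri> _ _ y<x with () ← subst (_≤ 0) (pairCoef-> y<x) c≤0

≤⇒pairCoef≤1 : ∀ {x y} → x ≤ y → pairCoef x y ≤ 1
≤⇒pairCoef≤1 {x} x≤y with m≤n⇒m<n∨m≡n x≤y
... | inj₁ x<y = ≤-trans (≤-reflexive (pairCoef-< x<y)) z≤n
... | inj₂ refl = ≤-reflexive (pairCoef-≡ x)

pairCoef-strictMono : ∀ (f : ℕ → ℕ) {a b} → (a < b → f a < f b) → (b < a → f b < f a) →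
  pairCoef (f a) (f b) ≡ pairCoef a b
pairCoef-strictMono f {a} {b} mono-ab mono-ba with <-cmp a b
... | tri< a<b _ _ = trans (pairCoef-< (mono-ab a<b)) (sym (pairCoef-< a<b))
... | tri≈ _ refl _ = trans (pairCoef-≡ (f a)) (sym (pairCoef-≡ a))
... | tri> _ _ b<a = trans (pairCoef-> (mono-ba b<a)) (sym (pairCoef-> b<a))

pairCoef-≤⇒≤ : ∀ {a b x y} → pairCoef a b ≤ pairCoef x y → x ≤ y → a ≤ b
pairCoef-≤⇒≤ ab≤xy x≤y = pairCoef≤1⇒≤ (≤-trans ab≤xy (≤⇒pairCoef≤1 x≤y))

pairCoef-≤⇒< : ∀ {a b x y} → pairCoef a b ≤ pairCoef x y → x < y → a < b
pairCoef-≤⇒< {a} {b} ab≤xy x<y = pairCoef≤0⇒< (subst (pairCoef a b ≤_) (pairCoef-< x<y) ab≤xy)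

-- The comparison pattern of a pair can only grow through a middle point,
-- unless the middle point creates an inversion the outer pair does not have.
pairCoef-≤-via : ∀ {a b d x y z} →
  pairCoef a b ≤ pairCoef x y → pairCoef b d ≤ pairCoef y z →
  (pairCoef x y ≡ 2 ⊎ pairCoef y z ≡ 2 → pairCoef x z ≡ 2) →
  pairCoef a d ≤ pairCoef x z
pairCoef-≤-via {a} {b} {d} {x} {y} {z} ab≤xy bd≤yz inversion with <-cmp x y | <-cmp y z
... | tri> _ _ y<x | _ = subst (pairCoef a d ≤_) (sym (inversion (inj₁ (pairCoef-> y<x)))) (pairCoef≤2 a d)
... | _ | tri> _ _ z<y = subst (pairCoef a d ≤_) (sym (inversion (inj₂ (pairCoef-> z<y)))) (pairCoef≤2 a d)
... | tri< x<y _ _ | tri< y<z _ _ =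
  ≤-reflexive (trans (pairCoef-< (<-≤-trans (pairCoef-≤⇒< ab≤xy x<y) (pairCoef-≤⇒≤ bd≤yz (<⇒≤ y<z))))
                     (sym (pairCoef-< (<-trans x<y y<z))))
... | tri< x<y _ _ | tri≈ _ refl _ =
  ≤-reflexive (trans (pairCoef-< (<-≤-trans (pairCoef-≤⇒< ab≤xy x<y) (pairCoef-≤⇒≤ bd≤yz ≤-refl)))
                     (sym (pairCoef-< x<y)))
... | tri≈ _ refl _ | tri< y<z _ _ =
  ≤-reflexive (trans (pairCoef-< (≤-<-trans (pairCoef-≤⇒≤ ab≤xy ≤-refl) (pairCoef-≤⇒< bd≤yz y<z)))
                     (sym (pairCoef-< y<z)))
... | tri≈ _ refl _ | tri≈ _ refl _ =
  subst (pairCoef a d ≤_) (sym (pairCoef-≡ x))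
    (≤⇒pairCoef≤1 (≤-trans (pairCoef-≤⇒≤ ab≤xy ≤-refl) (pairCoef-≤⇒≤ bd≤yz ≤-refl)))

Dominated : (ℕ → ℕ) → (ℕ → ℕ) → ℕ → Set
Dominated x y n = ∀ i j → i < j → j < n → pairCoef (x i) (x j) ≤ pairCoef (y i) (y j)

Dominated-≤ : ∀ {x y m n} → n ≤ m → Dominated x y m → Dominated x y n
Dominated-≤ n≤m dom i j i<j j<n = dom i j i<j (<-≤-trans j<n n≤m)

Dominated-shift : ∀ {x y} k {l} → Dominated x y (k + l) → Dominated (x ∘ (k +_)) (y ∘ (k +_)) l
Dominated-shift k dom i j i<j j<l = dom (k + i) (k + j) (+-monoʳ-< k i<j) (+-monoʳ-< k j<l)

SamePattern : (ℕ → ℕ) → (ℕ → ℕ) → ℕ → Set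
SamePattern x x′ n = ∀ i j → i < j → j < n → pairCoef (x i) (x j) ≡ pairCoef (x′ i) (x′ j)

SamePattern-refl : ∀ {x n} → SamePattern x x n
SamePattern-refl _ _ _ _ = refl

SamePattern-sym : ∀ {x x′ n} → SamePattern x x′ n → SamePattern x′ x n
SamePattern-sym same i j i<j j<n = sym (same i j i<j j<n)

SamePattern-trans : ∀ {x x′ x″ n} → SamePattern x x′ n → SamePattern x′ x″ n → SamePattern x x″ n
SamePattern-trans same same′ i j i<j j<n = trans (same i j i<j j<n) (same′ i j i<j j<n)

SamePattern-pointwise : ∀ {x x′ n} → (∀ {i} → i < n → x i ≡ x′ i) → SamePattern x x′ n
SamePattern-pointwise x≡ i j i<j j<n = cong₂ pairCoef (x≡ (<-trans i<j j<n)) (x≡ j<n)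

SamePattern-strictMono : ∀ {x n} f → f Preserves _<_ ⟶ _<_ → SamePattern (f ∘ x) x n
SamePattern-strictMono {x} f mono i j _ _ = pairCoef-strictMono f {x i} {x j} mono mono

Dominated-cong : ∀ {x x′ y y′ n} → SamePattern x x′ n → SamePattern y y′ n →
  Dominated x y n → Dominated x′ y′ n
Dominated-cong x≈ y≈ dom i j i<j j<n = subst₂ _≤_ (x≈ i j i<j j<n) (y≈ i j i<j j<n) (dom i j i<j j<n)

Dominated-unshift : ∀ {x y} k {l} → Dominated (x ∘ (k +_)) (y ∘ (k +_)) l →
  ∀ {i j} → k ≤ i → i < j → j < k + l → pairCoef (x i) (x j) ≤ pairCoef (y i) (y j)
Dominated-unshift k {l} dom k≤i i<j j<k+l
  with i′ , refl ← m≤n⇒∃[o]m+o≡n k≤i | j′ , refl ← m≤n⇒∃[o]m+o≡n (≤-trans k≤i (<⇒≤ i<j)) =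
  dom i′ j′ (+-cancelˡ-< k i′ j′ i<j) (+-cancelˡ-< k j′ l j<k+l)

Dominated-glue : ∀ {x y} k l →
  (∀ {i j} → i < k → k < j → j < k + l →
     pairCoef (y i) (y k) ≡ 2 ⊎ pairCoef (y k) (y j) ≡ 2 → pairCoef (y i) (y j) ≡ 2) →
  Dominated x y (suc k) → Dominated (x ∘ (k +_)) (y ∘ (k +_)) l → Dominated x y (k + l)
Dominated-glue {x} {y} k l inversion left right i j i<j j<k+l with j ≤? k | k ≤? i
... | yes j≤k | _ = left i j i<j (s≤s j≤k)
... | no _ | yes k≤i = Dominated-unshift k right k≤i i<j j<k+l
... | no j≰k | no k≰i =
  pairCoef-≤-via (left i k i<k (n<1+n k)) (Dominated-unshift k right ≤-refl k<j j<k+l) (inversion i<k k<j j<k+l)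
  where
  i<k : i < k
  i<k = ≰⇒> k≰i
  k<j : k < j
  k<j = ≰⇒> j≰k

_≼_ : Word → Word → Set
u ≼ v = length u ≡ length v × Dominated (at u) (at v) (length u)

T-and : ∀ {bs} → T (and bs) ⇔ All T bs
T-and {[]} = mk⇔ (λ _ → []) (λ _ → _)
T-and {b ∷ bs} = mk⇔
  (λ t → let tb , tbs = Equivalence.to (T-∧ {b}) t in tb ∷ Equivalence.to T-and tbs)
  (λ { (tb ∷ tbs) → Equivalence.from (T-∧ {b}) (tb , Equivalence.from T-and tbs) })

T-injective : ∀ {a b} → T a ⇔ T b → a ≡ b
T-injective {false} {false} _ = refl
T-injective {false} {true} a⇔b = ⊥-elim (Equivalence.from a⇔b _)
T-injective {true} {false} a⇔b = ⊥-elim (Equivalence.to a⇔b _)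
T-injective {true} {true} _ = refl

≤ᵖ-reflects-≼ : ∀ u v → T (u ≤ᵖ v) ⇔ u ≼ v
≤ᵖ-reflects-≼ u v = mk⇔ sound complete
  where
  n : ℕ
  n = length u

  sound : T (u ≤ᵖ v) → u ≼ v
  sound t with Equivalence.to (T-∧ {length u ≡ᵇ length v}) t
  ... | t-len , t-pairs = ≡ᵇ⇒≡ n (length v) t-len , λ i j i<j j<n →
    let rows = All.map⁻ (All.concat⁻ (Equivalence.to T-and t-pairs)) in
    subst₂ _≤_ (coef2≡pairCoef u i j) (coef2≡pairCoef v i j)
      (≤ᵇ⇒≤ _ _ (All.applyUpTo⁻ id j (All.map⁻ (All.applyUpTo⁻ id n rows j<n)) i<j))

  complete : u ≼ v → T (u ≤ᵖ v)
  complete (len≡ , dom) = Equivalence.from (T-∧ {length u ≡ᵇ length v})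
    ( ≡⇒≡ᵇ n (length v) len≡
    , Equivalence.from T-and (All.concat⁺ (All.map⁺ (All.applyUpTo⁺₁ id n λ {j} j<n →
        All.map⁺ (All.applyUpTo⁺₁ id _ λ {i} i<j →
        ≤⇒≤ᵇ (subst₂ _≤_ (sym (coef2≡pairCoef u i j)) (sym (coef2≡pairCoef v i j)) (dom i j i<j j<n)))))))

module _ {A B : Set} {P : Pred B 0ℓ} {Q : Pred A 0ℓ} (P? : Decidable P) (Q? : Decidable Q) where

  filter-map-local : ∀ (f : A → B) xs → (∀ {y} → y ∈ xs → P (f y) ⇔ Q y) →
    filter P? (map f xs) ≡ map f (filter Q? xs)
  filter-map-local f [] _ = refl
  filter-map-local f (x ∷ xs) P⇔Q with P? (f x) | Q? x
  ... | yes p | yes _ = cong (f x ∷_) (filter-map-local f xs (P⇔Q ∘ there))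
  ... | yes p | no ¬q = ⊥-elim (¬q (Equivalence.to (P⇔Q (here refl)) p))
  ... | no ¬p | yes q = ⊥-elim (¬p (Equivalence.from (P⇔Q (here refl)) q))
  ... | no _ | no _ = filter-map-local f xs (P⇔Q ∘ there)

module _ {A : Set} {P Q : Pred A 0ℓ} (P? : Decidable P) (Q? : Decidable Q) where

  filter-comm : ∀ xs → filter P? (filter Q? xs) ≡ filter Q? (filter P? xs)
  filter-comm [] = refl
  filter-comm (x ∷ xs) with P? x | Q? x
  ... | yes p | yes q
    rewrite filter-accept Q? {xs = filter P? xs} q | filter-accept P? {xs = filter Q? xs} p =
    cong (x ∷_) (filter-comm xs)
  ... | yes _ | no ¬q rewrite filter-reject Q? {xs = filter P? xs} ¬q = filter-comm xs
  ... | no ¬p | yes _ rewrite filter-reject P? {xs = filter Q? xs} ¬p = filter-comm xs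
  ... | no _ | no _ = filter-comm xs

  length-filter-mono : ∀ xs → (∀ {y} → P y → Q y) → length (filter P? xs) ≤ length (filter Q? xs)
  length-filter-mono [] _ = z≤n
  length-filter-mono (x ∷ xs) P⇒Q with P? x | Q? x
  ... | yes _ | yes _ = s≤s (length-filter-mono xs P⇒Q)
  ... | yes p | no ¬q = ⊥-elim (¬q (P⇒Q p))
  ... | no _ | yes _ = m≤n⇒m≤1+n (length-filter-mono xs P⇒Q)
  ... | no _ | no _ = length-filter-mono xs P⇒Q

  length-filter-strictMono : ∀ xs → (∀ {y} → P y → Q y) → ∀ {z} → z ∈ xs → Q z → ¬ P z →
    length (filter P? xs) < length (filter Q? xs)
  length-filter-strictMono (x ∷ xs) P⇒Q (here refl) qz ¬pz with P? x | Q? x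
  ... | yes pz | _ = ⊥-elim (¬pz pz)
  ... | no _ | yes _ = s≤s (length-filter-mono xs P⇒Q)
  ... | no _ | no ¬qz = ⊥-elim (¬qz qz)
  length-filter-strictMono (x ∷ xs) P⇒Q (there z∈xs) qz ¬pz with P? x | Q? x
  ... | yes _ | yes _ = s≤s (length-filter-strictMono xs P⇒Q z∈xs qz ¬pz)
  ... | yes p | no ¬q = ⊥-elim (¬q (P⇒Q p))
  ... | no _ | yes _ = m≤n⇒m≤1+n (length-filter-strictMono xs P⇒Q z∈xs qz ¬pz)
  ... | no _ | no _ = length-filter-strictMono xs P⇒Q z∈xs qz ¬pz

dedup : List ℕ → List ℕ
dedup = deduplicate _≟_

dedup-filter : ∀ {P : Pred ℕ 0ℓ} (P? : Decidable P) xs → dedup (filter P? xs) ≡ filter P? (dedup xs)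
dedup-filter P? [] = refl
dedup-filter P? (x ∷ xs) with P? x
... | yes _ = begin
  x ∷ filter (¬? ∘ (x ≟_)) (dedup (filter P? xs))  ≡⟨ cong ((x ∷_) ∘ filter (¬? ∘ (x ≟_))) (dedup-filter P? xs) ⟩
  x ∷ filter (¬? ∘ (x ≟_)) (filter P? (dedup xs))  ≡⟨ cong (x ∷_) (filter-comm (¬? ∘ (x ≟_)) P? (dedup xs)) ⟩
  x ∷ filter P? (filter (¬? ∘ (x ≟_)) (dedup xs))  ∎
  where open ≡-Reasoning
... | no ¬p = begin
  dedup (filter P? xs)                             ≡⟨ dedup-filter P? xs ⟩
  filter P? (dedup xs)                             ≡⟨ filter-all (¬? ∘ (x ≟_)) (All.tabulate x∉) ⟨
  filter (¬? ∘ (x ≟_)) (filter P? (dedup xs))      ≡⟨ filter-comm (¬? ∘ (x ≟_)) P? (dedup xs) ⟩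
  filter P? (filter (¬? ∘ (x ≟_)) (dedup xs))      ∎
  where
  open ≡-Reasoning
  x∉ : ∀ {y} → y ∈ filter P? (dedup xs) → x ≢ y
  x∉ y∈ refl = ¬p (proj₂ (∈-filter⁻ P? {xs = dedup xs} y∈))

InjectiveOn : List ℕ → (ℕ → ℕ) → Set
InjectiveOn xs f = ∀ {a b} → a ∈ xs → b ∈ xs → f a ≡ f b → a ≡ b

dedup-map : ∀ f xs → InjectiveOn xs f → dedup (map f xs) ≡ map f (dedup xs)
dedup-map f [] _ = refl
dedup-map f (x ∷ xs) inj = cong (f x ∷_) (begin
  filter (¬? ∘ (f x ≟_)) (dedup (map f xs))
    ≡⟨ cong (filter (¬? ∘ (f x ≟_))) (dedup-map f xs (λ a∈ b∈ → inj (there a∈) (there b∈))) ⟩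
  filter (¬? ∘ (f x ≟_)) (map f (dedup xs))
    ≡⟨ filter-map-local (¬? ∘ (f x ≟_)) (¬? ∘ (x ≟_)) f (dedup xs) distinct⇔ ⟩
  map f (filter (¬? ∘ (x ≟_)) (dedup xs))    ∎)
  where
  open ≡-Reasoning
  distinct⇔ : ∀ {y} → y ∈ dedup xs → f x ≢ f y ⇔ x ≢ y
  distinct⇔ y∈ = mk⇔ (λ fx≢fy x≡y → fx≢fy (cong f x≡y))
                     (λ x≢y fx≡fy → x≢y (inj (here refl) (there (∈-deduplicate⁻ _≟_ xs y∈)) fx≡fy))

StrictMonoOn : List ℕ → (ℕ → ℕ) → Set
StrictMonoOn xs f = ∀ {a b} → a ∈ xs → b ∈ xs → a < b → f a < f b

StrictMonoOn⇒InjectiveOn : ∀ {xs f} → StrictMonoOn xs f → InjectiveOn xs f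
StrictMonoOn⇒InjectiveOn {f = f} mono {a} {b} a∈ b∈ fa≡fb with <-cmp a b
... | tri< a<b _ _ = ⊥-elim (<-irrefl fa≡fb (mono a∈ b∈ a<b))
... | tri≈ _ a≡b _ = a≡b
... | tri> _ _ b<a = ⊥-elim (<-irrefl (sym fa≡fb) (mono b∈ a∈ b<a))

#distinctBelow-dedup : ∀ w x → #distinctBelow w x ≡ length (filter (_<? x) (dedup w))
#distinctBelow-dedup w x = cong length (dedup-filter (_<? x) w)

#distinctBelow-strictMono : ∀ w {x y} → x ∈ w → x < y → #distinctBelow w x < #distinctBelow w y
#distinctBelow-strictMono w {x} {y} x∈w x<y
  rewrite #distinctBelow-dedup w x | #distinctBelow-dedup w y =
  length-filter-strictMono (_<? x) (_<? y) (dedup w) (λ z<x → <-trans z<x x<y)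
    (∈-deduplicate⁺ _≟_ x∈w) x<y (<-irrefl refl)

#distinctBelow<length : ∀ w {x} → x ∈ w → #distinctBelow w x < length w
#distinctBelow<length w {x} x∈w = ≤-<-trans (length-deduplicate _≟_ (filter (_<? x) w))
  (filter-notAll (_<? x) w (Any.map (λ { refl → <-irrefl refl }) x∈w))

#distinctBelow-map : ∀ w f → StrictMonoOn w f → ∀ {x} → x ∈ w →
  #distinctBelow (map f w) (f x) ≡ #distinctBelow w x
#distinctBelow-map w f mono {x} x∈w = begin
  length (dedup (filter (_<? f x) (map f w)))
    ≡⟨ cong (length ∘ dedup) (filter-map-local (_<? f x) (_<? x) f w below⇔) ⟩
  length (dedup (map f (filter (_<? x) w)))
    ≡⟨ cong length (dedup-map f _ (λ a∈ b∈ → inj (filtered a∈) (filtered b∈))) ⟩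
  length (map f (dedup (filter (_<? x) w)))
    ≡⟨ length-map f (dedup (filter (_<? x) w)) ⟩
  length (dedup (filter (_<? x) w))             ∎
  where
  open ≡-Reasoning
  inj : InjectiveOn w f
  inj = StrictMonoOn⇒InjectiveOn mono
  filtered : ∀ {y} → y ∈ filter (_<? x) w → y ∈ w
  filtered = proj₁ ∘ ∈-filter⁻ (_<? x) {xs = w}
  below⇔ : ∀ {y} → y ∈ w → f y < f x ⇔ y < x
  below⇔ {y} y∈w = mk⇔ reflect (mono y∈w x∈w)
    where
    reflect : f y < f x → y < x
    reflect fy<fx with <-cmp y x
    ... | tri< y<x _ _ = y<x
    ... | tri≈ _ refl _ = ⊥-elim (<-irrefl refl fy<fx)
    ... | tri> _ _ x<y = ⊥-elim (<-asym fy<fx (mono x∈w y∈w x<y))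

-- pack w is definitionally map (rank w) w.
rank : Word → ℕ → ℕ
rank w x = suc (#distinctBelow w x)

rank-strictMono : ∀ w → StrictMonoOn w (rank w)
rank-strictMono w x∈w _ x<y = s≤s (#distinctBelow-strictMono w x∈w x<y)

pack-map : ∀ w f → StrictMonoOn w f → pack (map f w) ≡ pack w
pack-map w f mono = trans (sym (map-∘ w))
  (map-cong-local (All.tabulate (λ x∈w → cong suc (#distinctBelow-map w f mono x∈w))))

pack-idem : ∀ w → pack (pack w) ≡ pack w
pack-idem w = pack-map w (rank w) (rank-strictMono w)

pack-letters : ∀ w → All (λ a → 1 ≤ a × a ≤ length w) (pack w)
pack-letters w = All.map⁺ (All.tabulate (λ x∈w → s≤s z≤n , #distinctBelow<length w x∈w))

at-map : ∀ f w {i} → i < length w → at (map f w) i ≡ f (at w i)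
at-map f (x ∷ w) {zero} _ = refl
at-map f (x ∷ w) {suc i} (s≤s i<n) = at-map f w i<n

at-∈ : ∀ w {i} → i < length w → at w i ∈ w
at-∈ (x ∷ w) {zero} _ = here refl
at-∈ (x ∷ w) {suc i} (s≤s i<n) = there (at-∈ w i<n)

at-++ˡ : ∀ xs ys {i} → i < length xs → at (xs ++ ys) i ≡ at xs i
at-++ˡ (x ∷ xs) ys {zero} _ = refl
at-++ˡ (x ∷ xs) ys {suc i} (s≤s i<n) = at-++ˡ xs ys i<n

at-++ʳ : ∀ xs ys j → at (xs ++ ys) (length xs + j) ≡ at ys j
at-++ʳ [] ys j = refl
at-++ʳ (x ∷ xs) ys j = at-++ʳ xs ys j

at-take : ∀ k w {i} → i < k → at (take k w) i ≡ at w i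
at-take (suc k) [] _ = refl
at-take (suc k) (x ∷ w) {zero} _ = refl
at-take (suc k) (x ∷ w) {suc i} (s≤s i<k) = at-take k w i<k

at-drop : ∀ k w j → at (drop k w) j ≡ at w (k + j)
at-drop zero w j = refl
at-drop (suc k) [] j = refl
at-drop (suc k) (x ∷ w) j = at-drop k w j

last≡at : ∀ x xs → fromMaybe 0 (last (x ∷ xs)) ≡ at (x ∷ xs) (length xs)
last≡at x [] = refl
last≡at x (y ∷ xs) = last≡at y xs

maxL-≥ : ∀ {w x} → x ∈ w → x ≤ maxL w
maxL-≥ {x ∷ w} (here refl) = m≤m⊔n x (maxL w)
maxL-≥ {y ∷ w} (there x∈w) = m≤n⇒m≤o⊔n y (maxL-≥ x∈w)

pack-SamePattern : ∀ w → SamePattern (at (pack w)) (at w) (length w)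
pack-SamePattern w i j i<j j<n = begin
  pairCoef (at (pack w) i) (at (pack w) j)
    ≡⟨ cong₂ pairCoef (at-map (rank w) w i<n) (at-map (rank w) w j<n) ⟩
  pairCoef (rank w (at w i)) (rank w (at w j))
    ≡⟨ pairCoef-strictMono (rank w) (rank-strictMono w wi∈ wj∈) (rank-strictMono w wj∈ wi∈) ⟩
  pairCoef (at w i) (at w j)
    ∎
  where
  open ≡-Reasoning
  i<n : i < length w
  i<n = <-trans i<j j<n
  wi∈ : at w i ∈ w
  wi∈ = at-∈ w i<n
  wj∈ : at w j ∈ w
  wj∈ = at-∈ w j<n

pack-≼ : ∀ w x → pack w ≼ x ⇔ w ≼ x
pack-≼ w x = mk⇔
  (λ (len≡ , dom) → trans (sym |pack|) len≡ , packed⇒ (subst (Dominated (at (pack w)) (at x)) |pack| dom))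
  (λ (len≡ , dom) → trans |pack| len≡ , subst (Dominated (at (pack w)) (at x)) (sym |pack|) (⇒packed dom))
  where
  |pack| : length (pack w) ≡ length w
  |pack| = length-map (rank w) w
  packed⇒ : Dominated (at (pack w)) (at x) (length w) → Dominated (at w) (at x) (length w)
  packed⇒ = Dominated-cong (pack-SamePattern w) SamePattern-refl
  ⇒packed : Dominated (at w) (at x) (length w) → Dominated (at (pack w)) (at x) (length w)
  ⇒packed = Dominated-cong (SamePattern-sym (pack-SamePattern w)) SamePattern-refl

concatMap-map≡cartesianProductWith : ∀ {A B C : Set} (f : A → B → C) xs ys →
  concatMap (λ x → map (f x) ys) xs ≡ cartesianProductWith f xs ys
concatMap-map≡cartesianProductWith f [] ys = refl
concatMap-map≡cartesianProductWith f (x ∷ xs) ys =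
  cong (map (f x) ys ++_) (concatMap-map≡cartesianProductWith f xs ys)

wordsOver-unique : ∀ m n → Unique (wordsOver m n)
wordsOver-unique m zero = [] AllPairs.∷ AllPairs.[]
wordsOver-unique m (suc n) =
  subst Unique (sym (concatMap-map≡cartesianProductWith _∷_ (applyUpTo suc m) (wordsOver m n)))
    (Unique.cartesianProductWith⁺ _∷_ ∷-injective
      (Unique.applyUpTo⁺₁ suc m (λ i<j _ → <⇒≢ i<j ∘ suc-injective)) (wordsOver-unique m n))

∈-wordsOver : ∀ m p → All (λ a → 1 ≤ a × a ≤ m) p → p ∈ wordsOver m (length p)
∈-wordsOver m [] [] = here refl
∈-wordsOver m (suc a ∷ p) ((_ , a<m) ∷ letters) =
  subst (suc a ∷ p ∈_) (sym (concatMap-map≡cartesianProductWith _∷_ (applyUpTo suc m) (wordsOver m (length p))))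
    (∈-cartesianProductWith⁺ _∷_ (∈-applyUpTo⁺ suc a<m) (∈-wordsOver m p letters))

pack∈packedWords : ∀ w → pack w ∈ packedWords (length w)
pack∈packedWords w = ∈-filter⁺ (λ p → isPackedᵇ p Bool.≟ true)
  (subst (λ n → pack w ∈ wordsOver (length w) n) (length-map (rank w) w)
    (∈-wordsOver (length w) (pack w) (pack-letters w)))
  (⌊⌋-true (≡-dec _≟_ (pack (pack w)) (pack w)) (pack-idem w))

packedWords-unique : ∀ n → Unique (packedWords n)
packedWords-unique n = Unique.filter⁺ (λ p → isPackedᵇ p Bool.≟ true) (wordsOver-unique n n)

module MonoidSum {c ℓ} (M : Monoid c ℓ) where
  open Monoid M using (Carrier; _≈_; _∙_; ε; ∙-cong; identityˡ; identityʳ)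
    renaming (refl to ≈-refl; trans to ≈-trans)

  sum : {X : Set} → (X → Carrier) → List X → Carrier
  sum t = foldr (λ x acc → t x ∙ acc) ε

  sum-zero : ∀ {X : Set} {t : X → Carrier} xs → (∀ {x} → x ∈ xs → t x ≈ ε) → sum t xs ≈ ε
  sum-zero [] _ = ≈-refl
  sum-zero (x ∷ xs) zeros = ≈-trans (∙-cong (zeros (here refl)) (sum-zero xs (zeros ∘ there))) (identityˡ ε)

  sum-single : ∀ {X : Set} {t : X → Carrier} {m} xs → Unique xs → m ∈ xs →
    (∀ {x} → x ∈ xs → x ≢ m → t x ≈ ε) → sum t xs ≈ t m
  sum-single (x ∷ xs) (x∉xs AllPairs.∷ _) (here refl) zeros =
    ≈-trans (∙-cong ≈-refl (sum-zero xs (λ y∈xs → zeros (there y∈xs) (≢-sym (All.lookup x∉xs y∈xs)))))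
            (identityʳ _)
  sum-single (x ∷ xs) (x∉xs AllPairs.∷ xs!) (there m∈xs) zeros =
    ≈-trans (∙-cong (zeros (here refl) (All.lookup x∉xs m∈xs)) (sum-single xs xs! m∈xs (zeros ∘ there)))
            (identityˡ _)

pack-≤ᵖ-reflects-≼ : ∀ w x → T (pack w ≤ᵖ x) ⇔ w ≼ x
pack-≤ᵖ-reflects-≼ w x = ⇔.trans (≤ᵖ-reflects-≼ (pack w) x) (pack-≼ w x)

≤ᵖ⇒length≡ : ∀ w x → T (pack w ≤ᵖ x) → length w ≡ length x
≤ᵖ⇒length≡ w x = proj₁ ∘ Equivalence.to (pack-≤ᵖ-reflects-≼ w x)

module SeriesProperties {c ℓ} (K : Field c ℓ) where
  open Field K using (Carrier; _≈_; 0#; 1#; _*_; +-monoid; zeroˡ; zeroʳ; *-identityˡ; *-cong; reflexive)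
    renaming (refl to ≈-refl; trans to ≈-trans; sym to ≈-sym)
  open Series K
  open MonoidSum +-monoid

  ⟦_⟧ : Bool → Carrier
  ⟦ b ⟧ = if b then 1# else 0#

  ⟦∧⟧ : ∀ a b → ⟦ a ∧ b ⟧ ≈ ⟦ a ⟧ * ⟦ b ⟧
  ⟦∧⟧ false b = ≈-sym (zeroˡ ⟦ b ⟧)
  ⟦∧⟧ true b = ≈-sym (*-identityˡ ⟦ b ⟧)

  private
    below? : ∀ x v → Dec (v ≤ᵖ x ≡ true)
    below? x v = v ≤ᵖ x Bool.≟ true

    candidates : Word → List Word
    candidates x = filter (below? x) (packedWords (length x))

  S-indicator : ∀ x w → S x w ≈ ⟦ pack w ≤ᵖ x ⟧
  S-indicator x w with pack w ≤ᵖ x in pack≤x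
  ... | true = ≈-trans (sum-single (candidates x) (Unique.filter⁺ (below? x) (packedWords-unique (length x))) pack∈ others)
                       (reflexive (cong ⟦_⟧ (⌊⌋-true (≡-dec _≟_ (pack w) (pack w)) refl)))
    where
    pack∈ : pack w ∈ candidates x
    pack∈ = ∈-filter⁺ (below? x)
      (subst (λ n → pack w ∈ packedWords n) (≤ᵖ⇒length≡ w x (Equivalence.from T-≡ pack≤x)) (pack∈packedWords w))
      pack≤x
    others : ∀ {v} → v ∈ candidates x → v ≢ pack w → M v w ≈ 0#
    others {v} _ v≢pack = reflexive (cong ⟦_⟧ (⌊⌋-false (≡-dec _≟_ (pack w) v) (≢-sym v≢pack)))
  ... | false =
    sum-zero (candidates x) (λ {v} v∈ → reflexive (cong ⟦_⟧ (⌊⌋-false (≡-dec _≟_ (pack w) v) (pack≢ v∈))))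
    where
    pack≢ : ∀ {v} → v ∈ candidates x → pack w ≢ v
    pack≢ v∈ refl with () ← trans (sym pack≤x) (proj₂ (∈-filter⁻ (below? x) {xs = packedWords (length x)} v∈))

  S-length : ∀ x w → length w ≢ length x → S x w ≈ 0#
  S-length x w len≢ = ≈-trans (S-indicator x w) (reflexive (if-¬T (len≢ ∘ ≤ᵖ⇒length≡ w x)))

  module _ (f g : Ser) (q : ℕ) (f-vanishes : ∀ x → length x ≢ suc q → f x ≈ 0#) (w : Word) where

    private
      term : ℕ → Carrier
      term k = f (take k w) * g (drop (k ∸ 1) w)

      positions : List ℕ
      positions = applyUpTo suc (length w)

      position≤ : ∀ {k} → k ∈ positions → k ≤ length w
      position≤ k∈ with _ , i<n , refl ← ∈-applyUpTo⁻ suc k∈ = i<n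

      term-vanishes : ∀ {k} → k ∈ positions → k ≢ suc q → term k ≈ 0#
      term-vanishes k∈ k≢ with i , i<n , refl ← ∈-applyUpTo⁻ suc k∈ =
        ≈-trans (*-cong (f-vanishes (take (suc i) w) (k≢ ∘ trans (sym |take|))) ≈-refl) (zeroˡ _)
        where
        |take| : length (take (suc i) w) ≡ suc i
        |take| = trans (length-take (suc i) w) (m≤n⇒m⊓n≡m i<n)

    #-concentrated : (f # g) w ≈ f (take (suc q) w) * g (drop q w)
    #-concentrated with suc q ≤? length w
    ... | yes q<n = sum-single positions (Unique.applyUpTo⁺₁ suc (length w) λ i<j _ → <⇒≢ (s≤s i<j))
                      (∈-applyUpTo⁺ suc q<n) term-vanishes
    ... | no q≮n = ≈-trans (sum-zero positions (λ k∈ → term-vanishes k∈ (λ { refl → q≮n (position≤ k∈) })))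
                     (≈-sym (≈-trans (*-cong (f-vanishes (take (suc q) w) (q≮n ∘ long-take)) ≈-refl) (zeroˡ _)))
      where
      long-take : length (take (suc q) w) ≡ suc q → suc q ≤ length w
      long-take eq =
        subst (_≤ length w) eq (≤-reflexive (trans (length-take (suc q) w) (m≥n⇒m⊓n≡n (<⇒≤ (≰⇒> q≮n)))))

-- The two letter maps of α ∨ β, written for α_k = suc A, β₁ = suc B and
-- max β = suc M, so that the ∸ 1 cancels.
module Join (A B M : ℕ) (B≤M : B ≤ M) where

  left : ℕ → ℕ
  left a = if a ≤ᵇ suc A then a + suc B ∸ 1 else a + suc M ∸ 1

  right : ℕ → ℕ
  right b = if b <ᵇ suc B then b else b + suc A ∸ 1

  left-≤ : ∀ {a} → a ≤ suc A → left a ≡ a + B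
  left-≤ {a} a≤ = trans (if-T (≤⇒≤ᵇ a≤)) (cong (_∸ 1) (+-suc a B))

  left-> : ∀ {a} → suc A < a → left a ≡ a + M
  left-> {a} A< = trans (if-¬T (<⇒≱ A< ∘ ≤ᵇ⇒≤ a (suc A))) (cong (_∸ 1) (+-suc a M))

  right-< : ∀ {b} → b < suc B → right b ≡ b
  right-< b< = if-T (<⇒<ᵇ b<)

  right-≥ : ∀ {b} → suc B ≤ b → right b ≡ b + A
  right-≥ {b} B≤ = trans (if-¬T (≤⇒≯ B≤ ∘ <ᵇ⇒< b (suc B))) (cong (_∸ 1) (+-suc b A))

  left-strictMono : left Preserves _<_ ⟶ _<_
  left-strictMono {a} {a′} a<a′ with a ≤? suc A | a′ ≤? suc A
  ... | yes a≤ | yes a′≤ rewrite left-≤ a≤ | left-≤ a′≤ = +-monoˡ-< B a<a′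
  ... | yes a≤ | no a′≰ rewrite left-≤ a≤ | left-> (≰⇒> a′≰) = +-mono-<-≤ a<a′ B≤M
  ... | no a≰ | yes a′≤ = ⊥-elim (a≰ (≤-trans (<⇒≤ a<a′) a′≤))
  ... | no a≰ | no a′≰ rewrite left-> (≰⇒> a≰) | left-> (≰⇒> a′≰) = +-monoˡ-< M a<a′

  right-strictMono : right Preserves _<_ ⟶ _<_
  right-strictMono {b} {b′} b<b′ with b <? suc B | b′ <? suc B
  ... | yes b< | yes b′< rewrite right-< b< | right-< b′< = b<b′
  ... | yes b< | no b′≮ rewrite right-< b< | right-≥ (≮⇒≥ b′≮) = <-≤-trans b<b′ (m≤m+n b′ A)
  ... | no b≮ | yes b′< = ⊥-elim (b≮ (<-trans b<b′ b′<))
  ... | no b≮ | no b′≮ rewrite right-≥ (≮⇒≥ b≮) | right-≥ (≮⇒≥ b′≮) = +-monoˡ-< A b<b′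

  left-last≡right-first : left (suc A) ≡ right (suc B)
  left-last≡right-first = trans (left-≤ ≤-refl) (trans (cong suc (+-comm A B)) (sym (right-≥ ≤-refl)))

  -- The source of the inversions across the shared letter of α ∨ β.
  right<left : ∀ {a b} → 1 ≤ a → b ≤ suc M → suc A < a ⊎ b < suc B → right b < left a
  right<left {a} {b} 1≤a b≤ (inj₁ A<a) rewrite left-> A<a = ≤-<-trans right≤ (+-mono-<-≤ A<a (≤-refl {M}))
    where
    right≤ : right b ≤ suc A + M
    right≤ with b <? suc B
    ... | yes b< rewrite right-< b< = ≤-trans b≤ (s≤s (m≤n+m M A))
    ... | no b≮ rewrite right-≥ (≮⇒≥ b≮) = ≤-trans (+-monoˡ-≤ A b≤) (≤-reflexive (cong suc (+-comm M A)))
  right<left {a} {b} 1≤a b≤ (inj₂ b<) rewrite right-< b< = <-≤-trans b< left≥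
    where
    left≥ : suc B ≤ left a
    left≥ with a ≤? suc A
    ... | yes a≤ rewrite left-≤ a≤ = +-monoˡ-≤ B 1≤a
    ... | no a≰ rewrite left-> (≰⇒> a≰) = +-mono-≤ 1≤a B≤M

module ∨ᵖ-Blocks (u₀ : ℕ) (us : Word) (B : ℕ) (vs : Word) (A M : ℕ)
  (u-positive : All (1 ≤_) (u₀ ∷ us))
  (last-u : fromMaybe 0 (last (u₀ ∷ us)) ≡ suc A) (max-v : maxL (suc B ∷ vs) ≡ suc M) where

  u v U : Word
  u = u₀ ∷ us
  v = suc B ∷ vs
  U = u ∨ᵖ v

  k l : ℕ
  k = length us
  l = length v

  B≤M : B ≤ M
  B≤M = ≤-pred (subst (suc B ≤_) max-v (maxL-≥ {v} (here refl)))

  open Join A B M B≤M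

  -- The letter maps exactly as _∨ᵖ_ writes them for u and v.
  leftᵘᵛ rightᵘᵛ : ℕ → ℕ
  leftᵘᵛ a = if a ≤ᵇ fromMaybe 0 (last u) then a + suc B ∸ 1 else a + maxL v ∸ 1
  rightᵘᵛ b = if b <ᵇ suc B then b else b + fromMaybe 0 (last u) ∸ 1

  leftᵘᵛ≗left : ∀ a → leftᵘᵛ a ≡ left a
  leftᵘᵛ≗left a rewrite last-u | max-v = refl

  rightᵘᵛ≗right : ∀ b → rightᵘᵛ b ≡ right b
  rightᵘᵛ≗right b rewrite last-u = refl

  |map-u| : length (map leftᵘᵛ u) ≡ suc k
  |map-u| = length-map leftᵘᵛ u

  length-U : length U ≡ k + l
  length-U = begin
    length (map leftᵘᵛ u ++ map rightᵘᵛ vs)   ≡⟨ length-++ (map leftᵘᵛ u) ⟩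
    length (map leftᵘᵛ u) + length (map rightᵘᵛ vs) ≡⟨ cong₂ _+_ |map-u| (length-map rightᵘᵛ vs) ⟩
    suc k + length vs                          ≡⟨ +-suc k (length vs) ⟨
    k + l                                      ∎
    where open ≡-Reasoning

  at-U-left : ∀ {i} → i < suc k → at U i ≡ left (at u i)
  at-U-left {i} i<k = begin
    at (map leftᵘᵛ u ++ map rightᵘᵛ vs) i
      ≡⟨ at-++ˡ (map leftᵘᵛ u) (map rightᵘᵛ vs) (subst (i <_) (sym |map-u|) i<k) ⟩
    at (map leftᵘᵛ u) i                   ≡⟨ at-map leftᵘᵛ u i<k ⟩
    leftᵘᵛ (at u i)                       ≡⟨ leftᵘᵛ≗left (at u i) ⟩
    left (at u i)                         ∎
    where open ≡-Reasoning

  at-U-right : ∀ {j} → j < l → at U (k + j) ≡ right (at v j)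
  at-U-right {zero} _ = begin
    at U (k + 0)          ≡⟨ cong (at U) (+-identityʳ k) ⟩
    at U k                ≡⟨ at-U-left (n<1+n k) ⟩
    left (at u k)         ≡⟨ cong left (trans (sym (last≡at u₀ us)) last-u) ⟩
    left (suc A)          ≡⟨ left-last≡right-first ⟩
    right (suc B)         ∎
    where open ≡-Reasoning
  at-U-right {suc j} (s≤s j<l) = begin
    at U (k + suc j)                   ≡⟨ cong (at U) (trans (+-suc k j) (cong (_+ j) (sym |map-u|))) ⟩
    at U (length (map leftᵘᵛ u) + j)   ≡⟨ at-++ʳ (map leftᵘᵛ u) (map rightᵘᵛ vs) j ⟩
    at (map rightᵘᵛ vs) j              ≡⟨ at-map rightᵘᵛ vs j<l ⟩
    rightᵘᵛ (at vs j)                  ≡⟨ rightᵘᵛ≗right (at vs j) ⟩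
    right (at v (suc j))               ∎
    where open ≡-Reasoning

  U-left-pattern : SamePattern (at U) (at u) (suc k)
  U-left-pattern = SamePattern-trans (SamePattern-pointwise at-U-left) (SamePattern-strictMono left left-strictMono)

  U-right-pattern : SamePattern (at U ∘ (k +_)) (at v) l
  U-right-pattern = SamePattern-trans (SamePattern-pointwise at-U-right) (SamePattern-strictMono right right-strictMono)

  U-inversions : ∀ {i j} → i < k → k < j → j < k + l →
    pairCoef (at U i) (at U k) ≡ 2 ⊎ pairCoef (at U k) (at U j) ≡ 2 → pairCoef (at U i) (at U j) ≡ 2
  U-inversions {i} i<k k<j j<k+l inversion
    with j′ , refl ← m≤n⇒∃[o]m+o≡n (<⇒≤ k<j) =
    pairCoef-> (subst₂ _<_ (sym (at-U-right j′<l)) (sym (at-U-left i≤k))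
      (right<left (All.lookup u-positive (at-∈ u i≤k)) (subst (at v j′ ≤_) max-v (maxL-≥ (at-∈ v j′<l)))
        (Sum.map u-inversion v-inversion inversion)))
    where
    i≤k : i < suc k
    i≤k = <-trans i<k (n<1+n k)
    j′<l : j′ < l
    j′<l = +-cancelˡ-< k j′ l j<k+l
    0<j′ : 0 < j′
    0<j′ = +-cancelˡ-< k 0 j′ (subst (_< k + j′) (sym (+-identityʳ k)) k<j)
    u-inversion : pairCoef (at U i) (at U k) ≡ 2 → suc A < at u i
    u-inversion inv = subst (_< at u i) (trans (sym (last≡at u₀ us)) last-u)
      (pairCoef≡2⇒> (trans (sym (U-left-pattern i k i<k (n<1+n k))) inv))
    v-inversion : pairCoef (at U k) (at U (k + j′)) ≡ 2 → at v j′ < suc B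
    v-inversion inv = pairCoef≡2⇒>
      (trans (sym (U-right-pattern 0 j′ 0<j′ j′<l))
             (subst (λ m → pairCoef (at U m) (at U (k + j′)) ≡ 2) (sym (+-identityʳ k)) inv))

  suc-k≤k+l : suc k ≤ k + l
  suc-k≤k+l = subst (suc k ≤_) (sym (+-suc k (length vs))) (s≤s (m≤m+n k (length vs)))

  ∨ᵖ-≼ : ∀ w → w ≼ U ⇔ (take (suc k) w ≼ u × drop k w ≼ v)
  ∨ᵖ-≼ w = mk⇔ split glue
    where
    take-pattern : SamePattern (at w) (at (take (suc k) w)) (suc k)
    take-pattern = SamePattern-pointwise (sym ∘ at-take (suc k) w)

    drop-pattern : SamePattern (at w ∘ (k +_)) (at (drop k w)) l
    drop-pattern = SamePattern-pointwise (λ {j} _ → sym (at-drop k w j))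

    split : w ≼ U → take (suc k) w ≼ u × drop k w ≼ v
    split (len≡ , dom) = (|take| , take-dom) , (|drop| , drop-dom)
      where
      n≡ : length w ≡ k + l
      n≡ = trans len≡ length-U
      dom′ : Dominated (at w) (at U) (k + l)
      dom′ = subst (Dominated (at w) (at U)) n≡ dom
      |take| : length (take (suc k) w) ≡ suc k
      |take| = trans (length-take (suc k) w) (m≤n⇒m⊓n≡m (subst (suc k ≤_) (sym n≡) suc-k≤k+l))
      |drop| : length (drop k w) ≡ l
      |drop| = trans (length-drop k w) (trans (cong (_∸ k) n≡) (m+n∸m≡n k l))
      take-dom : Dominated (at (take (suc k) w)) (at u) (length (take (suc k) w))
      take-dom = subst (Dominated (at (take (suc k) w)) (at u)) (sym |take|)
        (Dominated-cong take-pattern U-left-pattern (Dominated-≤ suc-k≤k+l dom′))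
      drop-dom : Dominated (at (drop k w)) (at v) (length (drop k w))
      drop-dom = subst (Dominated (at (drop k w)) (at v)) (sym |drop|)
        (Dominated-cong drop-pattern U-right-pattern (Dominated-shift k dom′))

    glue : take (suc k) w ≼ u × drop k w ≼ v → w ≼ U
    glue ((|take| , take-dom) , (|drop| , drop-dom)) =
      trans n≡ (sym length-U) ,
      subst (Dominated (at w) (at U)) (sym n≡) (Dominated-glue k l U-inversions first-block second-block)
      where
      n∸k≡l : length w ∸ k ≡ l
      n∸k≡l = trans (sym (length-drop k w)) |drop|
      n≡ : length w ≡ k + l
      n≡ = trans (sym (m+[n∸m]≡n k≤n)) (cong (k +_) n∸k≡l)
        where
        k≤n : k ≤ length w
        k≤n = <⇒≤ (m∸n≢0⇒n<m (λ n∸k≡0 → 0≢1+n (trans (sym n∸k≡0) n∸k≡l)))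
      first-block : Dominated (at w) (at U) (suc k)
      first-block = Dominated-cong (SamePattern-sym take-pattern) (SamePattern-sym U-left-pattern)
        (subst (Dominated (at (take (suc k) w)) (at u)) |take| take-dom)
      second-block : Dominated (at w ∘ (k +_)) (at U ∘ (k +_)) l
      second-block = Dominated-cong (SamePattern-sym drop-pattern) (SamePattern-sym U-right-pattern)
        (subst (Dominated (at (drop k w)) (at v)) |drop| drop-dom)

  ∨ᵖ-≤ᵖ : ∀ w → (pack (take (suc k) w) ≤ᵖ u) ∧ (pack (drop k w) ≤ᵖ v) ≡ pack w ≤ᵖ U
  ∨ᵖ-≤ᵖ w = T-injective (⇔.trans T-∧ (⇔.trans
    (pack-≤ᵖ-reflects-≼ (take (suc k) w) u ×-⇔ pack-≤ᵖ-reflects-≼ (drop k w) v)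
    (⇔.sym (⇔.trans (pack-≤ᵖ-reflects-≼ w U) (∨ᵖ-≼ w)))))

packed-positive : ∀ {w} → IsPacked w → All (1 ≤_) w
packed-positive {w} packed = subst (All (1 ≤_)) packed (All.map proj₁ (pack-letters w))

packed-last-positive : ∀ {x xs} → IsPacked (x ∷ xs) → 1 ≤ fromMaybe 0 (last (x ∷ xs))
packed-last-positive {x} {xs} packed =
  subst (1 ≤_) (sym (last≡at x xs)) (All.lookup (packed-positive packed) (at-∈ (x ∷ xs) ≤-refl))

packed-maxL-positive : ∀ {x xs} → IsPacked (x ∷ xs) → 1 ≤ maxL (x ∷ xs)
packed-maxL-positive {x} {xs} packed = ≤-trans (All.head (packed-positive packed)) (maxL-≥ {x ∷ xs} (here refl))

proposition5p3 : ∀ {c ℓ} (K : Field c ℓ) (u v : List ℕ) →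
    IsPacked u → ¬ (u ≡ []) → IsPacked v → ¬ (v ≡ []) →
    let open Series K in (S u # S v) ≋ S (u ∨ᵖ v)
proposition5p3 K [] _ _ u≢[] _ _ = ⊥-elim (u≢[] refl)
proposition5p3 K (_ ∷ _) [] _ _ _ v≢[] = ⊥-elim (v≢[] refl)
proposition5p3 K (u₀ ∷ us) (b₁ ∷ vs) u-packed _ v-packed _ w _
  with A , A≡ ← m≤n⇒∃[o]m+o≡n (packed-last-positive u-packed)
     | B , refl ← m≤n⇒∃[o]m+o≡n (All.head (packed-positive v-packed))
     | M , M≡ ← m≤n⇒∃[o]m+o≡n (packed-maxL-positive v-packed)
  = begin
    (S u # S v) w                            ≈⟨ #-concentrated (S u) (S v) k (S-length u) w ⟩
    S u (take (suc k) w) * S v (drop k w)    ≈⟨ *-cong (S-indicator u (take (suc k) w)) (S-indicator v (drop k w)) ⟩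
    ⟦ first ⟧ * ⟦ second ⟧                   ≈⟨ ⟦∧⟧ first second ⟨
    ⟦ first ∧ second ⟧                       ≡⟨ cong ⟦_⟧ (∨ᵖ-≤ᵖ w) ⟩
    ⟦ pack w ≤ᵖ U ⟧                          ≈⟨ S-indicator U w ⟨
    S U w                                    ∎
  where
  open Field K using (_*_; *-cong; setoid)
  open Series K using (S; _#_)
  open SeriesProperties K
  open ∨ᵖ-Blocks u₀ us B vs A M (packed-positive u-packed) (sym A≡) (sym M≡)
  open import Relation.Binary.Reasoning.Setoid setoid
  first second : Bool
  first = pack (take (suc k) w) ≤ᵖ u
  second = pack (drop k w) ≤ᵖ v
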